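{- For all $m,n\in\mathbb{N}$ and all integers $a\ge0$, \[ \psi^{(a)}_m(n)=B_{a+1,n-1}+\frac{m(m-1)}{m+a}\,(n-1)\,B_{m+a-1,n-1}. \]
   Context: For integers $a,b\ge0$ let $B_{a,b}=\frac{(a+b)!}{a!\,b!}$. For $m,n\in\mathbb{N}=\{1,2,\dots\}$ define $\psi_m(n)=n+(m-1)(n-1)B_{m-1,n-1}$. Set $\psi^{(0)}_m=\psi_m$, and for $a\ge1$ define $\psi^{(a)}_m(n)=\sum_{\nu=1}^n\psi^{(a-1)}_m(\nu)$. -}

module Defs where

open import Data.Nat using (ℕ; zero; suc; _+_; _*_; _∸_; _/_)
open import Data.Nat.Combinatorics using (_C_)
open import Data.Nat.Properties using (m*n≢0)
open import Data.Nat.Base using (_!)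
open import Data.Nat.Properties using (_!≢0)

B : ℕ → ℕ → ℕ
B a b = ((a + b) !) / (a ! * b !)
  where instance _ = m*n≢0 (a !) (b !) {{a !≢0}} {{b !≢0}}

-- ψ_m(n) = n + (m-1)(n-1) B_{m-1,n-1}, intended for m, n ≥ 1
ψ : ℕ → ℕ → ℕ
ψ m n = n + (m ∸ 1) * (n ∸ 1) * B (m ∸ 1) (n ∸ 1)

sum1 : ℕ → (ℕ → ℕ) → ℕ
sum1 zero f = 0
sum1 (suc n) f = sum1 n f + f (suc n)

ψⁱ : ℕ → ℕ → ℕ → ℕ
ψⁱ zero m n = ψ m n
ψⁱ (suc a) m n = sum1 n (ψⁱ a m)

open import Data.Nat using (NonZero)

m+a≢0 : ∀ m a .{{_ : NonZero m}} → NonZero (m + a)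
m+a≢0 (suc m) a = _

-- With q = n - 1 and c = m + a - 1, absorption q B_{c,q} = (c + 1) B_{c+1,q-1} turns the
-- rational term into the integer m(m-1) B_{m+a,q-1}, so the claim becomes
-- ψ^{(a)}_m(q+1) = B_{a+1,q} + m(m-1) B_{m+a,q-1}. For a = 0 this is absorption once more;
-- the step ψ^{(a+1)}(q+2) = ψ^{(a+1)}(q+1) + ψ^{(a)}(q+2) is matched by Pascal's rule applied
-- to both binomials, which is why B is replaced by its Pascal-recursive form throughout.
module Submission where

open import Defs
open import Data.Nat using (ℕ; suc; _+_; _*_; _∸_; NonZero)
open import Data.Integer using (+_)
open import Data.Rational using (_/_)
open import Relation.Binary.PropositionalEquality using (_≡_)
import Data.Rational as Q

open import Data.Nat using (zero; _!)
open import Data.Nat.Properties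
  using (*-identityˡ; *-identityʳ; *-zeroʳ; *-assoc; +-identityʳ; *-cancelʳ-≡; m*n≢0; _!≢0; +-suc; +-comm)
open import Data.Nat.DivMod using (m*n/n≡m)
open import Data.Nat.Tactic.RingSolver using (solve-∀)
open import Relation.Binary.PropositionalEquality
  using (refl; sym; trans; cong; cong₂; module ≡-Reasoning)
import Data.Integer as ℤ
open import Data.Integer.Properties using (pos-*)
open import Data.Rational.Properties using (toℚᵘ-injective; toℚᵘ-fromℚᵘ; toℚᵘ-homo-+; toℚᵘ-homo-*)
import Data.Rational.Unnormalised as ℚᵘ
open import Data.Rational.Unnormalised.Properties
  using (≃-refl; +-cong; *-cong; module ≃-Reasoning)

pascal : ℕ → ℕ → ℕ
pascal zero    b       = 1
pascal (suc a) zero    = 1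
pascal (suc a) (suc b) = pascal a (suc b) + pascal (suc a) b

pascal-*-!≡! : ∀ a b → pascal a b * (a ! * b !) ≡ (a + b) !
pascal-*-!≡! zero b = trans (*-identityˡ _) (*-identityˡ _)
pascal-*-!≡! (suc a) zero =
  trans (*-identityˡ _) (trans (*-identityʳ _) (cong _! (sym (+-identityʳ (suc a)))))
pascal-*-!≡! (suc a) (suc b) = begin
  (P + Q) * ((suc a * a !) * (suc b * b !))
    ≡⟨ distrib P Q (suc a) (suc b) (a !) (b !) ⟩
  suc a * (P * (a ! * suc b !)) + suc b * (Q * (suc a ! * b !))
    ≡⟨ cong₂ (λ x y → suc a * x + suc b * y)
             (trans (pascal-*-!≡! a (suc b)) (cong _! (+-suc a b)))
             (pascal-*-!≡! (suc a) b) ⟩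
  suc a * suc (a + b) ! + suc b * suc (a + b) !
    ≡⟨ factor a b (suc (a + b) !) ⟩
  suc (suc (a + b)) * suc (a + b) !
    ≡⟨ cong (λ x → suc x !) (sym (+-suc a b)) ⟩
  (suc a + suc b) !
    ∎
  where
  open ≡-Reasoning
  P = pascal a (suc b)
  Q = pascal (suc a) b
  distrib : ∀ p q x y u v →
    (p + q) * ((x * u) * (y * v)) ≡ x * (p * (u * (y * v))) + y * (q * ((x * u) * v))
  distrib = solve-∀
  factor : ∀ a b f → suc a * f + suc b * f ≡ suc (suc (a + b)) * f
  factor = solve-∀

B≡pascal : ∀ a b → B a b ≡ pascal a b
B≡pascal a b = trans
  (cong (λ x → (x Data.Nat./ (a ! * b !)) {{a!b!≢0}}) (sym (pascal-*-!≡! a b)))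
  (m*n/n≡m (pascal a b) (a ! * b !) {{a!b!≢0}})
  where
  a!b!≢0 = m*n≢0 (a !) (b !) {{a !≢0}} {{b !≢0}}

pascal-1 : ∀ q → pascal 1 q ≡ suc q
pascal-1 zero    = refl
pascal-1 (suc q) = cong suc (pascal-1 q)

pascal-absorb : ∀ c r → suc r * pascal c (suc r) ≡ suc c * pascal (suc c) r
pascal-absorb c r = *-cancelʳ-≡ _ _ (c ! * r !) {{m*n≢0 (c !) (r !) {{c !≢0}} {{r !≢0}}}} (begin
  suc r * pascal c (suc r) * (c ! * r !)    ≡⟨ swap (suc r) (pascal c (suc r)) (c !) (r !) ⟩
  pascal c (suc r) * (c ! * suc r !)        ≡⟨ pascal-*-!≡! c (suc r) ⟩
  (c + suc r) !                             ≡⟨ cong _! (+-suc c r) ⟩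
  (suc c + r) !                             ≡⟨ pascal-*-!≡! (suc c) r ⟨
  pascal (suc c) r * (suc c ! * r !)        ≡⟨ unswap (suc c) (pascal (suc c) r) (c !) (r !) ⟩
  suc c * pascal (suc c) r * (c ! * r !)    ∎)
  where
  open ≡-Reasoning
  swap : ∀ x p u v → x * p * (u * v) ≡ p * (u * (x * v))
  swap = solve-∀
  unswap : ∀ x p u v → p * ((x * u) * v) ≡ x * p * (u * v)
  unswap = solve-∀

-- pascal c (q ∸ 1), except that it vanishes at q = 0; this is B_{m+a,n-2} of the closed form.
pascal⁻ : ℕ → ℕ → ℕ
pascal⁻ c zero    = 0
pascal⁻ c (suc q) = pascal c q

*-pascal≡*-pascal⁻ : ∀ c q → q * pascal c q ≡ suc c * pascal⁻ (suc c) q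
*-pascal≡*-pascal⁻ c zero    = sym (*-zeroʳ (suc c))
*-pascal≡*-pascal⁻ c (suc r) = pascal-absorb c r

pascal≡pascal⁻+pascal : ∀ c q → pascal (suc c) q ≡ pascal⁻ (suc c) q + pascal c q
pascal≡pascal⁻+pascal zero    zero    = refl
pascal≡pascal⁻+pascal (suc c) zero    = refl
pascal≡pascal⁻+pascal c       (suc r) = +-comm (pascal c (suc r)) (pascal (suc c) r)

ψ-closed : ∀ p q → ψ (suc p) (suc q) ≡ pascal 1 q + suc p * p * pascal⁻ (suc p) q
ψ-closed p q = begin
  suc q + p * q * B p q                    ≡⟨ cong₂ (λ x y → x + p * q * y) (sym (pascal-1 q)) (B≡pascal p q) ⟩
  pascal 1 q + p * q * pascal p q          ≡⟨ cong (λ x → pascal 1 q + x) (*-assoc p q _) ⟩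
  pascal 1 q + p * (q * pascal p q)        ≡⟨ cong (λ x → pascal 1 q + p * x) (*-pascal≡*-pascal⁻ p q) ⟩
  pascal 1 q + p * (suc p * pascal⁻ (suc p) q)  ≡⟨ cong (λ x → pascal 1 q + x) (reassoc p (suc p) _) ⟩
  pascal 1 q + suc p * p * pascal⁻ (suc p) q    ∎
  where
  open ≡-Reasoning
  reassoc : ∀ x y z → x * (y * z) ≡ y * x * z
  reassoc = solve-∀

-- Indexing by suc (a + p) rather than m + a makes the step in a definitional.
ψⁱ-closed : ∀ p a q → ψⁱ a (suc p) (suc q) ≡ pascal (suc a) q + suc p * p * pascal⁻ (suc (a + p)) q
ψⁱ-closed p zero    q       = ψ-closed p q
ψⁱ-closed p (suc a) zero    = ψⁱ-closed p a zero
ψⁱ-closed p (suc a) (suc r) = begin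
  ψⁱ (suc a) (suc p) (suc r) + ψⁱ a (suc p) (suc (suc r))
    ≡⟨ cong₂ _+_ (ψⁱ-closed p (suc a) r) (ψⁱ-closed p a (suc r)) ⟩
  (pascal (suc (suc a)) r + K * pascal⁻ (suc c) r) + (pascal (suc a) (suc r) + K * pascal c r)
    ≡⟨ regroup (pascal (suc (suc a)) r) (pascal (suc a) (suc r)) K (pascal⁻ (suc c) r) (pascal c r) ⟩
  pascal (suc (suc a)) (suc r) + K * (pascal⁻ (suc c) r + pascal c r)
    ≡⟨ cong (λ x → pascal (suc (suc a)) (suc r) + K * x) (pascal≡pascal⁻+pascal c r) ⟨
  pascal (suc (suc a)) (suc r) + K * pascal (suc c) r
    ∎
  where
  open ≡-Reasoning
  K = suc p * p
  c = suc (a + p)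
  regroup : ∀ x y k d e → (x + k * d) + (y + k * e) ≡ (y + x) + k * (d + e)
  regroup = solve-∀

-- The cross-multiplication condition of ℚᵘ.*≡* for the identity below, as it unfolds.
cross-multiplied : ∀ x k s d →
  + (x + k * d) ℤ.* + suc (s * 1 + 0) ≡
  (+ x ℤ.* + suc (s * 1) ℤ.+ (+ k ℤ.* + (suc s * d)) ℤ.* + 1) ℤ.* + 1
cross-multiplied x k s d = begin
  + (x + k * d) ℤ.* + suc (s * 1 + 0)
    ≡⟨ pos-* (x + k * d) (suc (s * 1 + 0)) ⟨
  + ((x + k * d) * suc (s * 1 + 0))
    ≡⟨ cong +_ (expand x k s d) ⟩
  + ((x * suc (s * 1) + k * (suc s * d) * 1) * 1)
    ≡⟨ trans (pos-* (x * suc (s * 1) + k * (suc s * d) * 1) 1) (cong (ℤ._* + 1) ints) ⟩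
  (+ x ℤ.* + suc (s * 1) ℤ.+ (+ k ℤ.* + (suc s * d)) ℤ.* + 1) ℤ.* + 1
    ∎
  where
  open ≡-Reasoning
  expand : ∀ x k s d → (x + k * d) * suc (s * 1 + 0) ≡ (x * suc (s * 1) + k * (suc s * d) * 1) * 1
  expand = solve-∀
  ints : + (x * suc (s * 1) + k * (suc s * d) * 1) ≡ + x ℤ.* + suc (s * 1) ℤ.+ (+ k ℤ.* + (suc s * d)) ℤ.* + 1
  ints = cong₂ ℤ._+_ (pos-* x (suc (s * 1)))
    (trans (pos-* (k * (suc s * d)) 1) (cong (ℤ._* + 1) (pos-* k (suc s * d))))

+[x+k*d]/1≡x/1+k/[1+s]*[[1+s]*d]/1 : ∀ x k s d →
  (+ (x + k * d)) / 1 ≡ (+ x) / 1 Q.+ (+ k) / suc s Q.* ((+ (suc s * d)) / 1)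
+[x+k*d]/1≡x/1+k/[1+s]*[[1+s]*d]/1 x k s d = toℚᵘ-injective (begin
  Q.toℚᵘ ((+ (x + k * d)) / 1)
    ≈⟨ toℚᵘ-fromℚᵘ (ℚᵘ.mkℚᵘ (+ (x + k * d)) 0) ⟩
  ℚᵘ.mkℚᵘ (+ (x + k * d)) 0
    ≈⟨ ℚᵘ.*≡* (cross-multiplied x k s d) ⟩
  ℚᵘ.mkℚᵘ (+ x) 0 ℚᵘ.+ ℚᵘ.mkℚᵘ (+ k) s ℚᵘ.* ℚᵘ.mkℚᵘ (+ (suc s * d)) 0
    ≈⟨ +-cong (toℚᵘ-fromℚᵘ (ℚᵘ.mkℚᵘ (+ x) 0))
              (*-cong (toℚᵘ-fromℚᵘ (ℚᵘ.mkℚᵘ (+ k) s)) (toℚᵘ-fromℚᵘ (ℚᵘ.mkℚᵘ (+ (suc s * d)) 0))) ⟨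
  Q.toℚᵘ X ℚᵘ.+ Q.toℚᵘ K ℚᵘ.* Q.toℚᵘ D
    ≈⟨ +-cong (≃-refl {Q.toℚᵘ X}) (toℚᵘ-homo-* K D) ⟨
  Q.toℚᵘ X ℚᵘ.+ Q.toℚᵘ (K Q.* D)
    ≈⟨ toℚᵘ-homo-+ X (K Q.* D) ⟨
  Q.toℚᵘ (X Q.+ K Q.* D)
    ∎)
  where
  open ≃-Reasoning
  X = (+ x) / 1
  K = (+ k) / suc s
  D = (+ (suc s * d)) / 1

lemma3 : (m n a : ℕ) → .{{_ : NonZero m}} → .{{_ : NonZero n}} →
    (+ ψⁱ a m n) / 1 ≡
      (+ B (suc a) (n ∸ 1)) / 1
        Q.+ ((+ (m * (m ∸ 1))) / (m + a)) {{Defs.m+a≢0 m a}} Q.* ((+ ((n ∸ 1) * B (m + a ∸ 1) (n ∸ 1))) / 1)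
lemma3 (suc p) (suc q) a = begin
  (+ ψⁱ a (suc p) (suc q)) / 1
    ≡⟨ cong (λ x → (+ x) / 1) closed ⟩
  (+ (B (suc a) q + suc p * p * pascal⁻ c q)) / 1
    ≡⟨ +[x+k*d]/1≡x/1+k/[1+s]*[[1+s]*d]/1 (B (suc a) q) (suc p * p) (p + a) (pascal⁻ c q) ⟩
  (+ B (suc a) q) / 1 Q.+ (+ (suc p * p)) / c Q.* ((+ (c * pascal⁻ c q)) / 1)
    ≡⟨ cong (λ x → (+ B (suc a) q) / 1 Q.+ (+ (suc p * p)) / c Q.* ((+ x) / 1)) absorbed ⟨
  (+ B (suc a) q) / 1 Q.+ (+ (suc p * p)) / c Q.* ((+ (q * B (p + a) q)) / 1)
    ∎
  where
  open ≡-Reasoning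
  c = suc (p + a)
  closed : ψⁱ a (suc p) (suc q) ≡ B (suc a) q + suc p * p * pascal⁻ c q
  closed = trans (ψⁱ-closed p a q)
    (cong₂ (λ x y → x + suc p * p * pascal⁻ (suc y) q) (sym (B≡pascal (suc a) q)) (+-comm a p))
  absorbed : q * B (p + a) q ≡ c * pascal⁻ c q
  absorbed = trans (cong (q *_) (B≡pascal (p + a) q)) (*-pascal≡*-pascal⁻ (p + a) q)
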